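{- Let $X=\{2^m: m\ge 0\}\times\{2^k:k\ge 0\}\subseteq\mathbb{N}^2$ and let $E=\{(a,b)\in\mathbb{N}^2: b\le\log_2 a\}\cup\{(a,b)\in\mathbb{N}^2: a\le\log_2 b\}$. Then: 1. $\mathbb{N}^2\setminus E\subseteq FS(X)$. 2. For every $D\in\mathbb{N}$ there exist $x_0,y_0\in\mathbb{N}$ such that the square $S_D=\{(s_1,s_2)\in\mathbb{N}^2: x_0\le s_1\le x_0+D,\ y_0\le s_2\le y_0+D\}$ satisfies $S_D\subseteq E$ and $FS(X)\cap S_D=\emptyset$.
   Context: $\mathbb{N}=\{1,2,3,\dots\}$, $\log_2$ is the base-2 logarithm. For $X\subseteq\mathbb{N}^2$, $FS(X)$ is the set of all sums $\sum_{x\in F}x$ over nonempty finite subsets $F\subseteq X$ (distinct elements, each used at most once). -}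

module Defs where

open import Data.Nat using (ℕ; _+_; _^_; _≤_)
open import Data.Nat.Logarithm using (⌊log₂_⌋)
open import Data.Product using (_×_; _,_; Σ; ∃-syntax)
open import Data.Sum using (_⊎_)
open import Data.List using (List; []; _∷_; foldr)
open import Data.List.Relation.Unary.All using (All)
open import Data.List.Relation.Unary.Unique.Propositional using (Unique)
open import Relation.Binary.PropositionalEquality using (_≡_)

-- ℕ = {1,2,3,...}: a natural number n is in ℕ iff 1 ≤ n.
Pos : ℕ → Set
Pos n = 1 ≤ n

InN² : ℕ × ℕ → Set
InN² (a , b) = Pos a × Pos b

InX : ℕ × ℕ → Set
InX (a , b) = (Σ ℕ λ m → a ≡ 2 ^ m) × (Σ ℕ λ k → b ≡ 2 ^ k)

sumPts : List (ℕ × ℕ) → ℕ × ℕ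
sumPts = foldr (λ { (a , b) (c , d) → (a + c , b + d) }) (0 , 0)

-- FS(X): sums of nonempty finite sets of distinct elements of X
-- (a finite set is given as a duplicate-free list)
FS : ℕ × ℕ → Set
FS p = ∃[ F ] (F ≢[] × All InX F × Unique F × sumPts F ≡ p)
  where
  _≢[] : List (ℕ × ℕ) → Set
  [] ≢[] = Data.Empty.⊥
    where import Data.Empty
  (_ ∷ _) ≢[] = Data.Unit.⊤
    where import Data.Unit

-- E = {(a,b) : b ≤ log₂ a} ∪ {(a,b) : a ≤ log₂ b}, on ℕ².
-- For integer b and a ≥ 1, b ≤ log₂ a  ⇔  b ≤ ⌊log₂ a⌋.
InE : ℕ × ℕ → Set
InE (a , b) = InN² (a , b) × (b ≤ ⌊log₂ a ⌋ ⊎ a ≤ ⌊log₂ b ⌋)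

module Submission where

open import Defs
open import Data.Nat using (ℕ; zero; suc; _+_; _*_; _^_; _∸_; _≤_; _<_; _<?_; z≤n; s≤s; z<s)
open import Data.Nat.Properties
open import Data.Nat.Logarithm using (⌊log₂_⌋; ⌊log₂⌋-mono-≤; ⌊log₂[2^n]⌋≡n)
open import Data.Nat.Tactic.RingSolver using (solve-∀)
open import Data.List using (List; []; _∷_; length; map; zipWith)
open import Data.List.Relation.Unary.All as All using (All; []; _∷_)
open import Data.List.Relation.Unary.AllPairs using ([]; _∷_)
open import Data.List.Relation.Unary.Unique.Propositional using (Unique)
open import Data.List.Relation.Unary.Unique.Propositional.Properties using (map⁺; map⁻)
open import Data.Product using (_×_; _,_; proj₁; proj₂; ∃-syntax)
open import Data.Sum using (_⊎_; inj₁; inj₂)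
open import Data.Unit using (tt)
open import Relation.Nullary using (¬_; yes; no; contradiction)
open import Relation.Binary.PropositionalEquality

-- An element of FS(X) with n summands pairs a way of writing its first
-- coordinate as a sum of n powers of two with one for its second coordinate,
-- at least one of the two exponent lists being duplicate-free.  A number a is
-- such a sum for every n from its binary length ≤ 1 + ⌊log₂ a⌋ up to a, since
-- 2^(e+1) splits into two copies of 2^e.  Outside E each coordinate exceeds
-- the logarithm of the other, so the binary expansions of a and b can be
-- padded to a common length.  Conversely, if (s₁ , s₂) ∈ FS(X) then s₁ is a
-- sum of at most s₂ powers of two, while 2^M − 1 is not a sum of fewer than M
-- of them.  Hence for M = 2D + 2 the square [2^M − 1 − D , 2^M − 1] × [1 , 1 + D]
-- misses FS(X), and it lies in E.

sum2^ : List ℕ → ℕ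
sum2^ []       = 0
sum2^ (e ∷ es) = 2 ^ e + sum2^ es

sum2^>0⇒length>0 : ∀ es → 0 < sum2^ es → 0 < length es
sum2^>0⇒length>0 (e ∷ es) _ = z<s

2^-injective : ∀ {m n} → 2 ^ m ≡ 2 ^ n → m ≡ n
2^-injective {m} {n} eq =
  trans (sym (⌊log₂[2^n]⌋≡n m)) (trans (cong ⌊log₂_⌋ eq) (⌊log₂[2^n]⌋≡n n))

n<2^n : ∀ n → n < 2 ^ n
n<2^n zero    = z<s
n<2^n (suc n) = subst (_≤ 2 ^ suc n) (+-comm (suc n) 1)
  (+-mono-≤ (n<2^n n) (≤-trans (m^n>0 2 n) (m≤m+n (2 ^ n) 0)))

n<2^[1+⌊log₂n⌋] : ∀ n → n < 2 ^ suc ⌊log₂ n ⌋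
n<2^[1+⌊log₂n⌋] n with n <? 2 ^ suc ⌊log₂ n ⌋
... | yes n<2^ = n<2^
... | no  n≮2^ = contradiction
  (subst (_≤ ⌊log₂ n ⌋) (⌊log₂[2^n]⌋≡n (suc ⌊log₂ n ⌋)) (⌊log₂⌋-mono-≤ (≮⇒≥ n≮2^)))
  1+n≰n

binary-expansion< : ∀ L a → a < 2 ^ L →
  ∃[ es ] (Unique es × All (_< L) es × length es ≤ L × sum2^ es ≡ a)
binary-expansion< zero    zero    _         = [] , [] , [] , z≤n , refl
binary-expansion< zero    (suc a) (s≤s ())
binary-expansion< (suc L) a       a<2^[1+L] with a <? 2 ^ L
... | yes a<2^L with binary-expansion< L a a<2^L
...   | es , unique , bounded , len , sum =
  es , unique , All.map m<n⇒m<1+n bounded , m≤n⇒m≤1+n len , sum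
binary-expansion< (suc L) a       a<2^[1+L] | no a≮2^L
  with binary-expansion< L (a ∸ 2 ^ L)
         (m<n+o⇒m∸n<o a (2 ^ L) {{m^n≢0 2 L}}
           (subst (a <_) (cong (2 ^ L +_) (+-identityʳ (2 ^ L))) a<2^[1+L]))
...   | es , unique , bounded , len , sum =
  L ∷ es , All.map >⇒≢ bounded ∷ unique , n<1+n L ∷ All.map m<n⇒m<1+n bounded , s≤s len ,
  trans (cong (2 ^ L +_) sum) (m+[n∸m]≡n (≮⇒≥ a≮2^L))

binary-expansion : ∀ a → ∃[ es ] (Unique es × length es ≤ suc ⌊log₂ a ⌋ × sum2^ es ≡ a)
binary-expansion a with binary-expansion< (suc ⌊log₂ a ⌋) a (n<2^[1+⌊log₂n⌋] a)
... | es , unique , _ , len , sum = es , unique , len , sum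

split-positive-exponent : ∀ es → length es < sum2^ es →
  ∃[ es′ ] (length es′ ≡ suc (length es) × sum2^ es′ ≡ sum2^ es)
split-positive-exponent (zero ∷ es) (s≤s len<sum) with split-positive-exponent es len<sum
... | es′ , len , sum = zero ∷ es′ , cong suc len , cong suc sum
split-positive-exponent (suc e ∷ es) _ =
  e ∷ e ∷ es , refl ,
  trans (sym (+-assoc (2 ^ e) (2 ^ e) (sum2^ es)))
        (cong (λ x → 2 ^ e + x + sum2^ es) (sym (+-identityʳ (2 ^ e))))

sum2^-with-length : ∀ n es → length es ≤ n → n ≤ sum2^ es →
  ∃[ es′ ] (length es′ ≡ n × sum2^ es′ ≡ sum2^ es)
sum2^-with-length zero    []       _ _ = [] , refl , refl
sum2^-with-length (suc n) es es≤1+n 1+n≤sum with m≤n⇒m<n∨m≡n es≤1+n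
... | inj₂ es≡1+n = es , es≡1+n , refl
... | inj₁ (s≤s es≤n) with sum2^-with-length n es es≤n (≤-trans (n≤1+n n) 1+n≤sum)
...   | es′ , len , sum
  with split-positive-exponent es′ (subst₂ _<_ (sym len) (sym sum) 1+n≤sum)
...     | es″ , len′ , sum′ = es″ , trans len′ (cong suc len) , trans sum′ sum

powerPair : ℕ → ℕ → ℕ × ℕ
powerPair e f = 2 ^ e , 2 ^ f

powerPairs-InX : ∀ es fs → All InX (zipWith powerPair es fs)
powerPairs-InX []       _        = []
powerPairs-InX (e ∷ es) []       = []
powerPairs-InX (e ∷ es) (f ∷ fs) = ((e , refl) , (f , refl)) ∷ powerPairs-InX es fs

sumPts-powerPairs : ∀ es fs → length es ≡ length fs →
  sumPts (zipWith powerPair es fs) ≡ (sum2^ es , sum2^ fs)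
sumPts-powerPairs []       []       _  = refl
sumPts-powerPairs (e ∷ es) (f ∷ fs) eq rewrite sumPts-powerPairs es fs (suc-injective eq) = refl

map-proj₁-powerPairs : ∀ es fs → length es ≡ length fs →
  map proj₁ (zipWith powerPair es fs) ≡ map (2 ^_) es
map-proj₁-powerPairs []       []       _  = refl
map-proj₁-powerPairs (e ∷ es) (f ∷ fs) eq = cong (2 ^ e ∷_) (map-proj₁-powerPairs es fs (suc-injective eq))

map-proj₂-powerPairs : ∀ es fs → length es ≡ length fs →
  map proj₂ (zipWith powerPair es fs) ≡ map (2 ^_) fs
map-proj₂-powerPairs []       []       _  = refl
map-proj₂-powerPairs (e ∷ es) (f ∷ fs) eq = cong (2 ^ f ∷_) (map-proj₂-powerPairs es fs (suc-injective eq))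

powerPairs-unique : ∀ es fs → length es ≡ length fs → Unique es ⊎ Unique fs →
  Unique (zipWith powerPair es fs)
powerPairs-unique es fs eq (inj₁ unique) = map⁻ {f = proj₁}
  (subst Unique (sym (map-proj₁-powerPairs es fs eq)) (map⁺ 2^-injective unique))
powerPairs-unique es fs eq (inj₂ unique) = map⁻ {f = proj₂}
  (subst Unique (sym (map-proj₂-powerPairs es fs eq)) (map⁺ 2^-injective unique))

FS-powerPairs : ∀ es fs → length es ≡ length fs → 0 < length es → Unique es ⊎ Unique fs →
  FS (sum2^ es , sum2^ fs)
FS-powerPairs es@(_ ∷ _) fs@(_ ∷ _) eq _ unique =
  zipWith powerPair es fs , tt , powerPairs-InX es fs , powerPairs-unique es fs eq unique ,
  sumPts-powerPairs es fs eq

FS-sum2^ : ∀ es fs → Unique es → Unique fs → 0 < length es →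
  length es ≤ sum2^ fs → length fs ≤ sum2^ es → FS (sum2^ es , sum2^ fs)
FS-sum2^ es fs es-unique fs-unique es-nonempty es≤fs-sum fs≤es-sum
  with ≤-total (length es) (length fs)
... | inj₁ es≤fs with sum2^-with-length (length fs) es es≤fs fs≤es-sum
...   | es′ , len , sum = subst (λ x → FS (x , sum2^ fs)) sum
  (FS-powerPairs es′ fs len (≤-trans es-nonempty (subst (length es ≤_) (sym len) es≤fs)) (inj₂ fs-unique))
FS-sum2^ es fs es-unique fs-unique es-nonempty es≤fs-sum fs≤es-sum
    | inj₂ fs≤es with sum2^-with-length (length es) fs fs≤es es≤fs-sum
...   | fs′ , len , sum = subst (λ x → FS (sum2^ es , x)) sum
  (FS-powerPairs es fs′ (sym len) es-nonempty (inj₁ es-unique))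

outside-E⇒FS : (p : ℕ × ℕ) → InN² p → ¬ InE p → FS p
outside-E⇒FS (a , b) (a>0 , b>0) ∉E with binary-expansion a | binary-expansion b
... | A , A-unique , A-len , refl | B , B-unique , B-len , refl =
  FS-sum2^ A B A-unique B-unique (sum2^>0⇒length>0 A a>0)
    (≤-trans A-len (≰⇒> (λ b≤log₂a → ∉E ((a>0 , b>0) , inj₁ b≤log₂a))))
    (≤-trans B-len (≰⇒> (λ a≤log₂b → ∉E ((a>0 , b>0) , inj₂ a≤log₂b))))

first-exponents : ∀ F → All InX F →
  ∃[ es ] (length es ≤ proj₂ (sumPts F) × sum2^ es ≡ proj₁ (sumPts F))
first-exponents []      []                                  = [] , z≤n , refl
first-exponents (_ ∷ F) (((m , refl) , (k , refl)) ∷ F-inX) with first-exponents F F-inX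
... | es , len , sum = m ∷ es , +-mono-≤ (m^n>0 2 k) len , cong (2 ^ m +_) sum

FS⇒sum2^-of-few-terms : ∀ {s₁ s₂} → FS (s₁ , s₂) → ∃[ es ] (length es ≤ s₂ × sum2^ es ≡ s₁)
FS⇒sum2^-of-few-terms (F , _ , F-inX , _ , F-sum) with first-exponents F F-inX
... | es , len , sum = es , subst (length es ≤_) (cong proj₂ F-sum) len , trans sum (cong proj₁ F-sum)

zeroCount : List ℕ → ℕ
zeroCount []           = 0
zeroCount (zero  ∷ es) = suc (zeroCount es)
zeroCount (suc _ ∷ es) = zeroCount es

halvePositive : List ℕ → List ℕ
halvePositive []           = []
halvePositive (zero  ∷ es) = halvePositive es
halvePositive (suc e ∷ es) = e ∷ halvePositive es

sum2^-halvePositive : ∀ es → sum2^ es ≡ zeroCount es + 2 * sum2^ (halvePositive es)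
sum2^-halvePositive []           = refl
sum2^-halvePositive (zero  ∷ es) = cong suc (sum2^-halvePositive es)
sum2^-halvePositive (suc e ∷ es) = begin
  2 ^ suc e + sum2^ es                                      ≡⟨ cong (2 ^ suc e +_) (sum2^-halvePositive es) ⟩
  2 * 2 ^ e + (zeroCount es + 2 * sum2^ (halvePositive es)) ≡⟨ regroup (2 ^ e) (zeroCount es) (sum2^ (halvePositive es)) ⟩
  zeroCount es + 2 * (2 ^ e + sum2^ (halvePositive es))     ∎
  where
  open ≡-Reasoning
  regroup : ∀ p z s → 2 * p + (z + 2 * s) ≡ z + 2 * (p + s)
  regroup = solve-∀

length-halvePositive : ∀ es → length es ≡ zeroCount es + length (halvePositive es)
length-halvePositive []           = refl
length-halvePositive (zero  ∷ es) = cong suc (length-halvePositive es)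
length-halvePositive (suc e ∷ es) =
  trans (cong suc (length-halvePositive es)) (sym (+-suc (zeroCount es) _))

even⊎odd : ∀ n → ∃[ u ] (n ≡ 2 * u ⊎ n ≡ suc (2 * u))
even⊎odd zero = 0 , inj₁ refl
even⊎odd (suc n) with even⊎odd n
... | u , inj₁ even = u , inj₂ (cong suc even)
... | u , inj₂ odd  = suc u , inj₁ (trans (cong suc odd) (cong suc (sym (+-suc u (u + 0)))))

+-sum2^-halvePositive : ∀ t es → t + sum2^ es ≡ t + zeroCount es + 2 * sum2^ (halvePositive es)
+-sum2^-halvePositive t es = trans (cong (t +_) (sum2^-halvePositive es)) (sym (+-assoc t _ _))

+-length-halvePositive : ∀ t es → t + length es ≡ t + zeroCount es + length (halvePositive es)
+-length-halvePositive t es = trans (cong (t +_) (length-halvePositive es)) (sym (+-assoc t _ _))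

-- t counts extra summands 2⁰.  Halving all positive exponents turns 2^(M+1) − 1
-- into 2^M − 1, the odd number 2u + 1 of summands 2⁰ becoming u summands 2⁰.
1+t+sum2^≡2^M⇒M≤t+length : ∀ M t es → suc (t + sum2^ es) ≡ 2 ^ M → M ≤ t + length es
1+t+sum2^≡2^M⇒M≤t+length zero    t es _  = z≤n
1+t+sum2^≡2^M⇒M≤t+length (suc M) t es eq with even⊎odd (t + zeroCount es)
... | u , inj₁ even = contradiction (begin
  2 * 2 ^ M                           ≡⟨ sym eq ⟩
  suc (t + sum2^ es)                  ≡⟨ cong suc (+-sum2^-halvePositive t es) ⟩
  suc (t + zeroCount es + 2 * s)      ≡⟨ cong (λ x → suc (x + 2 * s)) even ⟩
  suc (2 * u + 2 * s)                 ≡⟨ cong suc (sym (*-distribˡ-+ 2 u s)) ⟩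
  suc (2 * (u + s))                   ∎)
  (even≢odd (2 ^ M) (u + s))
  where
  open ≡-Reasoning
  s = sum2^ (halvePositive es)
... | u , inj₂ odd = begin
  suc M                               ≤⟨ s≤s (1+t+sum2^≡2^M⇒M≤t+length M u (halvePositive es) halved) ⟩
  suc (u + length (halvePositive es)) ≤⟨ s≤s (+-monoˡ-≤ _ (m≤m+n u (u + 0))) ⟩
  suc (2 * u) + length (halvePositive es)       ≡⟨ cong (_+ length (halvePositive es)) odd ⟨
  t + zeroCount es + length (halvePositive es)  ≡⟨ +-length-halvePositive t es ⟨
  t + length es                       ∎
  where
  open ≤-Reasoning
  s = sum2^ (halvePositive es)
  halved : suc (u + s) ≡ 2 ^ M
  halved = *-cancelˡ-≡ (suc (u + s)) (2 ^ M) 2 (begin-equality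
    2 * suc (u + s)                   ≡⟨ double-odd u s ⟩
    suc (suc (2 * u) + 2 * s)         ≡⟨ cong (λ x → suc (x + 2 * s)) odd ⟨
    suc (t + zeroCount es + 2 * s)    ≡⟨ cong suc (+-sum2^-halvePositive t es) ⟨
    suc (t + sum2^ es)                ≡⟨ eq ⟩
    2 * 2 ^ M                         ∎)
    where
    double-odd : ∀ u s → 2 * suc (u + s) ≡ suc (suc (2 * u) + 2 * s)
    double-odd = solve-∀

FS∧1+t+s₁≡2^M⇒M≤t+s₂ : ∀ {s₁ s₂} M t → FS (s₁ , s₂) → suc (t + s₁) ≡ 2 ^ M → M ≤ t + s₂
FS∧1+t+s₁≡2^M⇒M≤t+s₂ M t fs eq with FS⇒sum2^-of-few-terms fs
... | es , len , refl = ≤-trans (1+t+sum2^≡2^M⇒M≤t+length M t es eq) (+-monoʳ-≤ t len)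

square-in-E-avoiding-FS : (D : ℕ) →
  ∃[ x₀ ] ∃[ y₀ ] (Pos x₀ × Pos y₀ ×
    ((s₁ s₂ : ℕ) → x₀ ≤ s₁ → s₁ ≤ x₀ + D → y₀ ≤ s₂ → s₂ ≤ y₀ + D →
      InE (s₁ , s₂) × ¬ FS (s₁ , s₂)))
square-in-E-avoiding-FS D = x₀ , 1 , ≤-trans (m^n>0 2 (suc D)) 2^[1+D]≤x₀ , z<s , in-E-not-FS
  where
  open ≤-Reasoning
  M : ℕ
  M = suc (suc (D + D))
  x₀ : ℕ
  x₀ = 2 ^ M ∸ suc D

  2^[1+D]+[1+D]≤2^M : 2 ^ suc D + suc D ≤ 2 ^ M
  2^[1+D]+[1+D]≤2^M = begin
    2 ^ suc D + suc D      ≤⟨ +-monoʳ-≤ (2 ^ suc D) (<⇒≤ (n<2^n (suc D))) ⟩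
    2 ^ suc D + 2 ^ suc D  ≡⟨ cong (2 ^ suc D +_) (+-identityʳ (2 ^ suc D)) ⟨
    2 ^ suc (suc D)        ≤⟨ ^-monoʳ-≤ 2 (s≤s (s≤s (m≤m+n D D))) ⟩
    2 ^ M                  ∎

  2^[1+D]≤x₀ : 2 ^ suc D ≤ x₀
  2^[1+D]≤x₀ = m+n≤o⇒m≤o∸n (2 ^ suc D) 2^[1+D]+[1+D]≤2^M

  1+x₀+D≡2^M : suc (x₀ + D) ≡ 2 ^ M
  1+x₀+D≡2^M = trans (sym (+-suc x₀ D)) (m∸n+n≡m (≤-trans (m≤n+m (suc D) _) 2^[1+D]+[1+D]≤2^M))

  in-E-not-FS : (s₁ s₂ : ℕ) → x₀ ≤ s₁ → s₁ ≤ x₀ + D → 1 ≤ s₂ → s₂ ≤ suc D →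
    InE (s₁ , s₂) × ¬ FS (s₁ , s₂)
  in-E-not-FS s₁ s₂ x₀≤s₁ s₁≤x₀+D 1≤s₂ s₂≤1+D =
    ((≤-trans (m^n>0 2 (suc D)) 2^[1+D]≤s₁ , 1≤s₂) , inj₁ s₂≤⌊log₂s₁⌋) , ∉FS
    where
    2^[1+D]≤s₁ : 2 ^ suc D ≤ s₁
    2^[1+D]≤s₁ = ≤-trans 2^[1+D]≤x₀ x₀≤s₁

    s₂≤⌊log₂s₁⌋ : s₂ ≤ ⌊log₂ s₁ ⌋
    s₂≤⌊log₂s₁⌋ = begin
      s₂                    ≤⟨ s₂≤1+D ⟩
      suc D                 ≡⟨ ⌊log₂[2^n]⌋≡n (suc D) ⟨
      ⌊log₂ 2 ^ suc D ⌋     ≤⟨ ⌊log₂⌋-mono-≤ 2^[1+D]≤s₁ ⟩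
      ⌊log₂ s₁ ⌋            ∎

    t : ℕ
    t = x₀ + D ∸ s₁

    ∉FS : ¬ FS (s₁ , s₂)
    ∉FS fs = 1+n≰n (begin
      M             ≤⟨ FS∧1+t+s₁≡2^M⇒M≤t+s₂ M t fs (trans (cong suc (m∸n+n≡m s₁≤x₀+D)) 1+x₀+D≡2^M) ⟩
      t + s₂        ≤⟨ +-mono-≤ (≤-trans (∸-monoʳ-≤ (x₀ + D) x₀≤s₁) (≤-reflexive (m+n∸m≡n x₀ D))) s₂≤1+D ⟩
      D + suc D     ≡⟨ +-suc D D ⟩
      suc (D + D)   ∎)

proposition1p4 :
    ((p : ℕ × ℕ) → InN² p → ¬ InE p → FS p)
    × ((D : ℕ) → Pos D →
        ∃[ x₀ ] ∃[ y₀ ] (Pos x₀ × Pos y₀ ×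
          ((s₁ s₂ : ℕ) → x₀ ≤ s₁ → s₁ ≤ x₀ + D → y₀ ≤ s₂ → s₂ ≤ y₀ + D →
            InE (s₁ , s₂) × ¬ FS (s₁ , s₂))))
proposition1p4 = outside-E⇒FS , λ D _ → square-in-E-avoiding-FS D
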